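{- Let $G$ be a finite, connected, undirected multigraph without loops, let $x\neq y$ be vertices, and let $k_{xy}$ be an integer. Let $G_1$ be the multigraph obtained from $G$ by deleting $k_{xy}$ of the edges between $x$ and $y$ if $k_{xy}\ge 0$ (assuming $G$ has at least $k_{xy}$ such edges), or by adding $|k_{xy}|$ edges between $x$ and $y$ if $k_{xy}<0$; assume $G_1$ is connected. Let $S$ be the subgroup of $\mathrm{Jac}(G)$ generated by $[\delta_{xy}]$ and $S_1$ the subgroup of $\mathrm{Jac}(G_1)$ generated by $[\delta_{xy}]$. Then $$[\mathrm{Jac}(G):S]\ \Big|\ \gcd(|\mathrm{Jac}(G)|,|\mathrm{Jac}(G_1)|)\quad\text{and}\quad [\mathrm{Jac}(G_1):S_1]\ \Big|\ \gcd(|\mathrm{Jac}(G)|,|\mathrm{Jac}(G_1)|).$$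
   Context: For a finite connected loopless multigraph $H$ with vertex set $V(H)$: a divisor is an element of $\mathbb{Z}^{V(H)}$; its degree is the sum of its values; $\mathrm{Div}^0(H)$ is the group of degree-zero divisors. The Laplacian is $L=\Delta-A$, where $\Delta$ is the diagonal matrix of vertex valencies and $A_{vw}$ is the number of edges between $v$ and $w$. Principal divisors are those of the form $L\sigma$ with $\sigma\in\mathbb{Z}^{V(H)}$, and $\mathrm{Jac}(H)=\mathrm{Div}^0(H)/\{L\sigma\}$, a finite abelian group whose order equals the number of spanning trees of $H$. For vertices $x\neq y$, $\delta_{xy}$ is the divisor with value $-1$ at $x$, $1$ at $y$ and $0$ elsewhere, and $[\delta_{xy}]$ is its class in the Jacobian. -}

module Defs where

open import Data.Nat using (ℕ; zero; suc)
open import Data.Integer using (ℤ; +_; _+_; _-_; _*_; -_; ∣_∣)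
open import Data.Fin using (Fin)
import Data.Fin as Fin
open import Data.Product using (Σ; ∃; _×_; _,_)
open import Data.Bool using (Bool; true; false; if_then_else_; _∧_; _∨_)
open import Relation.Nullary using (¬_)
open import Relation.Nullary.Decidable using (⌊_⌋)
open import Relation.Binary.PropositionalEquality using (_≡_)

-- A multigraph on vertex set Fin n is given by its adjacency matrix:
-- A v w = number of edges between v and w.
Adj : ℕ → Set
Adj n = Fin n → Fin n → ℕ

Symmetric : ∀ {n} → Adj n → Set
Symmetric {n} A = (v w : Fin n) → A v w ≡ A w v

Loopless : ∀ {n} → Adj n → Set
Loopless {n} A = (v : Fin n) → A v v ≡ 0

data Reach {n : ℕ} (A : Adj n) : Fin n → Fin n → Set where
  here : ∀ {v} → Reach A v v
  step : ∀ {u v w} → ¬ (A u v ≡ 0) → Reach A v w → Reach A u w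

Connected : ∀ {n} → Adj n → Set
Connected {n} A = (v w : Fin n) → Reach A v w

Div : ℕ → Set
Div n = Fin n → ℤ

Σℤ : ∀ {n} → (Fin n → ℤ) → ℤ
Σℤ {zero}  f = + 0
Σℤ {suc n} f = f Fin.zero + Σℤ (λ i → f (Fin.suc i))

deg : ∀ {n} → Div n → ℤ
deg D = Σℤ D

Div⁰ : ∀ {n} → Div n → Set
Div⁰ D = deg D ≡ + 0

valency : ∀ {n} → Adj n → Fin n → ℤ
valency A v = Σℤ (λ w → + A v w)

Lap : ∀ {n} → Adj n → (Fin n → ℤ) → Div n
Lap A σ v = valency A v * σ v - Σℤ (λ w → + A v w * σ w)

δ : ∀ {n} → Fin n → Fin n → Div n
δ x y v = if ⌊ v Fin.≟ x ⌋ then - (+ 1) else (if ⌊ v Fin.≟ y ⌋ then + 1 else + 0)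

JacRel : ∀ {n} → Adj n → Div n → Div n → Set
JacRel {n} A D D' = ∃ λ (σ : Fin n → ℤ) → ∀ v → D v - D' v ≡ Lap A σ v

-- D ~ D' in Jac(A)/⟨[δ_xy]⟩: D - D' ∈ principal + ℤ δ_xy
CosetRel : ∀ {n} → Adj n → Fin n → Fin n → Div n → Div n → Set
CosetRel {n} A x y D D' =
  ∃ λ (m : ℤ) → ∃ λ (σ : Fin n → ℤ) → ∀ v → D v - D' v ≡ Lap A σ v + m * δ x y v

-- The quotient of Div⁰ by an equivalence R has exactly N elements:
-- there is a complete, irredundant system of N representatives.
QuotCard : ∀ {n} → (Div n → Div n → Set) → ℕ → Set
QuotCard {n} R N =
  Σ (Fin N → Div n) λ rep →
    ((i : Fin N) → Div⁰ (rep i)) ×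
    ((i j : Fin N) → R (rep i) (rep j) → i ≡ j) ×
    ((D : Div n) → Div⁰ D → ∃ λ (i : Fin N) → R D (rep i))

JacOrder : ∀ {n} → Adj n → ℕ → Set
JacOrder A N = QuotCard (JacRel A) N

JacIndex : ∀ {n} → Adj n → Fin n → Fin n → ℕ → Set
JacIndex A x y N = QuotCard (CosetRel A x y) N

isPair : ∀ {n} → Fin n → Fin n → Fin n → Fin n → Bool
isPair x y u v = (⌊ u Fin.≟ x ⌋ ∧ ⌊ v Fin.≟ y ⌋) ∨ (⌊ u Fin.≟ y ⌋ ∧ ⌊ v Fin.≟ x ⌋)

modify : ∀ {n} → Adj n → Fin n → Fin n → ℤ → Adj n
modify A x y k u v = if isPair x y u v then ∣ + A u v - k ∣ else A u v

module Submission where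

-- The Laplacian of the modified graph satisfies L₁σ = Lσ + k(σ(x) − σ(y)) δ_xy,
-- so the preimages L(ℤⁿ) + ℤδ_xy of S ⊆ Jac(G) and of S₁ ⊆ Jac(G₁) in Div are
-- the same group, and the two indices coincide.  By Lagrange's theorem this common
-- index divides both |Jac(G)| and |Jac(G₁)|, hence their gcd.

open import Defs
open import Level using (Level)
open import Data.Nat using (ℕ; zero; suc) renaming (_*_ to _*ℕ_)
open import Data.Nat.Divisibility using (_∣_; divides)
open import Data.Nat.GCD using (gcd; gcd-greatest)
import Data.Nat.Properties as ℕ
open import Data.Integer using (ℤ; +_; _+_; _-_; _*_; -_; ∣_∣) renaming (_≤_ to _≤ℤ_)
open import Data.Integer.Properties
  using (+-assoc; +-identityˡ; +-identityʳ; +-inverseʳ; *-zeroʳ; 0≤i⇒+∣i∣≡i; i≤j⇒0≤j-i)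
open import Data.Integer.Tactic.RingSolver using (solve-∀)
open import Data.Fin using (Fin; zero; suc; _≟_)
open import Data.Fin.Properties using (*↔×)
open import Data.Fin.Permutation using (↔⇒≡)
open import Data.Product using (Σ; ∃; _×_; _,_; proj₁; proj₂)
import Data.Product as Product
open import Data.Product.Properties using (Σ-≡,≡→≡)
open import Data.Sum using (_⊎_; inj₁; inj₂; [_,_])
open import Data.Bool using (true; false; if_then_else_; _∧_; _∨_)
open import Data.Empty using (⊥-elim)
open import Function using (id)
open import Function.Bundles using (_↔_; mk↔ₛ′; Inverse)
open import Function.Properties.Inverse using (↔-refl; ↔-sym; ↔-trans)
open import Data.Product.Algebra using (×-cong)
open import Axiom.UniquenessOfIdentityProofs using (module Decidable⇒UIP)
open import Relation.Nullary using (¬_; yes; no)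
open import Relation.Nullary.Decidable using (Dec; does; ⌊_⌋; isYes≗does; dec-true; dec-false; _×-dec_; _⊎-dec_)
open import Relation.Unary using (Pred; Decidable; Irrelevant; _⊆_)
open import Relation.Binary.PropositionalEquality
  using (_≡_; refl; sym; trans; cong; cong₂; subst; _≗_; module ≡-Reasoning)

private variable
  ℓ : Level
  n : ℕ

Σℤ-cong : {f g : Fin n → ℤ} → (∀ i → f i ≡ g i) → Σℤ f ≡ Σℤ g
Σℤ-cong {zero}  eq = refl
Σℤ-cong {suc n} eq = cong₂ _+_ (eq zero) (Σℤ-cong (λ i → eq (suc i)))

Σℤ-0 : Σℤ {n} (λ _ → + 0) ≡ + 0
Σℤ-0 {zero}  = refl
Σℤ-0 {suc n} = trans (+-identityˡ _) (Σℤ-0 {n})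

Σℤ-+ : (f g : Fin n → ℤ) → Σℤ (λ i → f i + g i) ≡ Σℤ f + Σℤ g
Σℤ-+ {zero}  f g = refl
Σℤ-+ {suc n} f g =
  trans (cong (_+_ (f zero + g zero)) (Σℤ-+ (λ i → f (suc i)) (λ i → g (suc i))))
        (interchange (f zero) (g zero) _ _)
  where
  interchange : ∀ a b c d → (a + b) + (c + d) ≡ (a + c) + (b + d)
  interchange = solve-∀

Σℤ-- : (f g : Fin n → ℤ) → Σℤ (λ i → f i - g i) ≡ Σℤ f - Σℤ g
Σℤ-- {zero}  f g = refl
Σℤ-- {suc n} f g =
  trans (cong (_+_ (f zero - g zero)) (Σℤ-- (λ i → f (suc i)) (λ i → g (suc i))))
        (interchange (f zero) (g zero) _ _)
  where
  interchange : ∀ a b c d → (a - b) + (c - d) ≡ (a + c) - (b + d)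
  interchange = solve-∀

Σℤ-update : (f g : Fin n → ℤ) (i₀ : Fin n) → (∀ i → ¬ i ≡ i₀ → f i ≡ g i) →
            Σℤ f ≡ Σℤ g + (f i₀ - g i₀)
Σℤ-update f g zero eq =
  trans (cong (_+_ (f zero)) (Σℤ-cong (λ i → eq (suc i) λ ())))
        (shift (f zero) (g zero) _)
  where
  shift : ∀ a b s → a + s ≡ (b + s) + (a - b)
  shift = solve-∀
Σℤ-update f g (suc i₀) eq =
  trans (cong₂ _+_ (eq zero λ ()) (Σℤ-update (λ i → f (suc i)) (λ i → g (suc i)) i₀
                                              (λ i i≢i₀ → eq (suc i) λ { refl → i≢i₀ refl })))
        (sym (+-assoc (g zero) _ _))

-- Subgroups of divisors and Lagrange's theorem

infixl 6 _⊕_ _⊖_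

_⊕_ : Div n → Div n → Div n
(D ⊕ E) v = D v + E v

_⊖_ : Div n → Div n → Div n
(D ⊖ E) v = D v - E v

0ᴰ : Div n
0ᴰ _ = + 0

Div⁰-0ᴰ : Div⁰ (0ᴰ {n})
Div⁰-0ᴰ {n} = Σℤ-0 {n}

Div⁰-⊕ : (D E : Div n) → Div⁰ D → Div⁰ E → Div⁰ (D ⊕ E)
Div⁰-⊕ D E d e = trans (Σℤ-+ D E) (cong₂ _+_ d e)

Div⁰-⊖ : (D E : Div n) → Div⁰ D → Div⁰ E → Div⁰ (D ⊖ E)
Div⁰-⊖ D E d e = trans (Σℤ-- D E) (cong₂ _-_ d e)

-- Divisors are functions, so without function extensionality a subgroup has
-- to be closed under pointwise equality explicitly.
record IsSubgroup (H : Pred (Div n) ℓ) : Set ℓ where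
  field
    respects-≗ : ∀ {D E} → D ≗ E → H D → H E
    has-0ᴰ     : H 0ᴰ
    ⊖-closed   : ∀ {D E} → H D → H E → H (D ⊖ E)

infix 4 _∼[_]_

-- A record rather than H (D ⊖ E), so that D and E can be inferred from the type.
record _∼[_]_ (D : Div n) (H : Pred (Div n) ℓ) (E : Div n) : Set ℓ where
  constructor ⟨_⟩
  field difference∈ : H (D ⊖ E)

module SubgroupProperties {H : Pred (Div n) ℓ} (H-sub : IsSubgroup H) where
  open IsSubgroup H-sub

  ⊕-closed : ∀ {D E} → H D → H E → H (D ⊕ E)
  ⊕-closed {D} {E} hD hE =
    respects-≗ (λ v → identity (D v) (E v)) (⊖-closed hD (⊖-closed has-0ᴰ hE))
    where
    identity : ∀ a b → a - (+ 0 - b) ≡ a + b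
    identity = solve-∀

  ≗⇒∼ : ∀ {D E} → D ≗ E → D ∼[ H ] E
  ≗⇒∼ {D} {E} D≗E =
    ⟨ respects-≗ (λ v → sym (trans (cong (_- E v) (D≗E v)) (+-inverseʳ (E v)))) has-0ᴰ ⟩

  ∼-refl : ∀ {D} → D ∼[ H ] D
  ∼-refl = ≗⇒∼ λ _ → refl

  ∼-sym : ∀ {D E} → D ∼[ H ] E → E ∼[ H ] D
  ∼-sym {D} {E} ⟨ h ⟩ = ⟨ respects-≗ (λ v → identity (D v) (E v)) (⊖-closed has-0ᴰ h) ⟩
    where
    identity : ∀ a b → + 0 - (a - b) ≡ b - a
    identity = solve-∀

  ∼-trans : ∀ {D E F} → D ∼[ H ] E → E ∼[ H ] F → D ∼[ H ] F
  ∼-trans {D} {E} {F} ⟨ h ⟩ ⟨ h′ ⟩ =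
    ⟨ respects-≗ (λ v → identity (D v) (E v) (F v)) (⊕-closed h h′) ⟩
    where
    identity : ∀ a b c → (a - b) + (b - c) ≡ a - c
    identity = solve-∀

  ⊕-cong : ∀ {D D′ E E′} → D ∼[ H ] D′ → E ∼[ H ] E′ → D ⊕ E ∼[ H ] D′ ⊕ E′
  ⊕-cong {D} {D′} {E} {E′} ⟨ h ⟩ ⟨ h′ ⟩ =
    ⟨ respects-≗ (λ v → identity (D v) (D′ v) (E v) (E′ v)) (⊕-closed h h′) ⟩
    where
    identity : ∀ a a′ b b′ → (a - a′) + (b - b′) ≡ (a + b) - (a′ + b′)
    identity = solve-∀

  ⊖-cong : ∀ {D D′ E E′} → D ∼[ H ] D′ → E ∼[ H ] E′ → D ⊖ E ∼[ H ] D′ ⊖ E′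
  ⊖-cong {D} {D′} {E} {E′} ⟨ h ⟩ ⟨ h′ ⟩ =
    ⟨ respects-≗ (λ v → identity (D v) (D′ v) (E v) (E′ v)) (⊖-closed h h′) ⟩
    where
    identity : ∀ a a′ b b′ → (a - a′) - (b - b′) ≡ (a - b) - (a′ - b′)
    identity = solve-∀

Σ-Fin↔Fin : {P : Pred (Fin n) ℓ} → Decidable P → Irrelevant P → ∃ λ k → Σ (Fin n) P ↔ Fin k
Σ-Fin↔Fin {zero}  P? irr = 0 , mk↔ₛ′ (λ ()) (λ ()) (λ ()) (λ ())
Σ-Fin↔Fin {suc n} {P = P} P? irr with Σ-Fin↔Fin (λ i → P? (suc i)) irr | P? zero
... | k , e | yes p = suc k , mk↔ₛ′ to from to-from from-to
  where
  open Inverse e using ()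
    renaming (to to e-to; from to e-from; strictlyInverseˡ to e-to-from; strictlyInverseʳ to e-from-to)
  to : Σ (Fin (suc n)) P → Fin (suc k)
  to (zero  , _) = zero
  to (suc i , q) = suc (e-to (i , q))
  from : Fin (suc k) → Σ (Fin (suc n)) P
  from zero    = zero , p
  from (suc j) = Product.map suc id (e-from j)
  to-from : ∀ j → to (from j) ≡ j
  to-from zero    = refl
  to-from (suc j) = cong suc (e-to-from j)
  from-to : ∀ x → from (to x) ≡ x
  from-to (zero  , q) = cong (zero ,_) (irr p q)
  from-to (suc i , q) = cong (Product.map suc id) (e-from-to (i , q))
... | k , e | no ¬p = k , mk↔ₛ′ to from e-to-from from-to
  where
  open Inverse e using ()
    renaming (to to e-to; from to e-from; strictlyInverseˡ to e-to-from; strictlyInverseʳ to e-from-to)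
  to : Σ (Fin (suc n)) P → Fin k
  to (zero  , q) = ⊥-elim (¬p q)
  to (suc i , q) = e-to (i , q)
  from : Fin k → Σ (Fin (suc n)) P
  from j = Product.map suc id (e-from j)
  from-to : ∀ x → from (to x) ≡ x
  from-to (zero  , q) = ⊥-elim (¬p q)
  from-to (suc i , q) = cong (Product.map suc id) (e-from-to (i , q))

QuotCard-map : {R R′ : Div n → Div n → Set} {N : ℕ} →
               (∀ D E → R D E → R′ D E) → (∀ D E → R′ D E → R D E) →
               QuotCard R N → QuotCard R′ N
QuotCard-map R⇒R′ R′⇒R (rep , rep-Div⁰ , rep-injective , rep-surjective) =
  rep , rep-Div⁰ , (λ i j r → rep-injective i j (R′⇒R (rep i) (rep j) r)) ,
  λ D d → let (i , r) = rep-surjective D d in i , R⇒R′ D (rep i) r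

module Classes {H : Div n → Set} (H-sub : IsSubgroup H) {N : ℕ} (q : QuotCard _∼[ H ]_ N) where
  open SubgroupProperties H-sub

  rep : Fin N → Div n
  rep = proj₁ q

  rep-Div⁰ : ∀ i → Div⁰ (rep i)
  rep-Div⁰ = proj₁ (proj₂ q)

  class : (D : Div n) → Div⁰ D → Fin N
  class D d = proj₁ (proj₂ (proj₂ (proj₂ q)) D d)

  class-spec : ∀ {D} (d : Div⁰ D) → D ∼[ H ] rep (class D d)
  class-spec {D} d = proj₂ (proj₂ (proj₂ (proj₂ q)) D d)

  class-unique : ∀ {D i} (d : Div⁰ D) → D ∼[ H ] rep i → class D d ≡ i
  class-unique d D∼i = proj₁ (proj₂ (proj₂ q)) _ _ (∼-trans (∼-sym (class-spec d)) D∼i)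

  class-resp : ∀ {D E} (d : Div⁰ D) (e : Div⁰ E) → D ∼[ H ] E → class D d ≡ class E e
  class-resp d e D∼E = class-unique d (∼-trans D∼E (class-spec e))

  class-≡⇒∼ : ∀ {D E} (d : Div⁰ D) (e : Div⁰ E) → class D d ≡ class E e → D ∼[ H ] E
  class-≡⇒∼ d e eq = ∼-trans (class-spec d) (subst (λ i → rep i ∼[ H ] _) (sym eq) (∼-sym (class-spec e)))

-- A class modulo H is determined by its class modulo K together with an
-- offset lying in the fibre K/H; hence N = I · |K/H|.
module Lagrange {H K : Div n → Set} (H-sub : IsSubgroup H) (K-sub : IsSubgroup K) (H⊆K : H ⊆ K)
                {N I : ℕ} (qH : QuotCard _∼[ H ]_ N) (qK : QuotCard _∼[ K ]_ I) where
  module J = Classes H-sub qH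
  module C = Classes K-sub qK
  module H = SubgroupProperties H-sub
  module K = SubgroupProperties K-sub

  ∼H⇒∼K : ∀ {D E} → D ∼[ H ] E → D ∼[ K ] E
  ∼H⇒∼K ⟨ h ⟩ = ⟨ H⊆K h ⟩

  Fibre : Fin N → Set
  Fibre j = C.class (J.rep j) (J.rep-Div⁰ j) ≡ C.class 0ᴰ (Div⁰-0ᴰ {n})

  coset : Fin N → Fin I
  coset i = C.class (J.rep i) (J.rep-Div⁰ i)

  offset : Fin N → Fin N
  offset i = J.class (J.rep i ⊖ C.rep (coset i))
                     (Div⁰-⊖ (J.rep i) (C.rep (coset i)) (J.rep-Div⁰ i) (C.rep-Div⁰ (coset i)))

  offset-spec : ∀ i → J.rep (offset i) ∼[ H ] J.rep i ⊖ C.rep (coset i)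
  offset-spec i = H.∼-sym (J.class-spec _)

  offset∈Fibre : ∀ i → Fibre (offset i)
  offset∈Fibre i = C.class-resp _ _
    (K.∼-trans (∼H⇒∼K (offset-spec i))
    (K.∼-trans (K.⊖-cong (C.class-spec (J.rep-Div⁰ i)) (K.∼-refl {C.rep (coset i)}))
               (K.≗⇒∼ λ v → +-inverseʳ (C.rep (coset i) v))))

  translate : Fin I → Fin N → Fin N
  translate a j = J.class (C.rep a ⊕ J.rep j) (Div⁰-⊕ (C.rep a) (J.rep j) (C.rep-Div⁰ a) (J.rep-Div⁰ j))

  translate-offset : ∀ i → translate (coset i) (offset i) ≡ i
  translate-offset i = J.class-unique _
    (H.∼-trans (H.⊕-cong (H.∼-refl {C.rep (coset i)}) (offset-spec i))
               (H.≗⇒∼ λ v → identity (C.rep (coset i) v) (J.rep i v)))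
    where
    identity : ∀ r d → r + (d - r) ≡ d
    identity = solve-∀

  module _ (a : Fin I) (j : Fin N) (j∈Fibre : Fibre j) where
    private
      i = translate a j
      rep-i : J.rep i ∼[ H ] C.rep a ⊕ J.rep j
      rep-i = H.∼-sym (J.class-spec _)

    coset-translate : coset i ≡ a
    coset-translate = C.class-unique _
      (K.∼-trans (∼H⇒∼K rep-i)
      (K.∼-trans (K.⊕-cong (K.∼-refl {C.rep a}) (C.class-≡⇒∼ _ _ j∈Fibre))
                 (K.≗⇒∼ λ v → +-identityʳ (C.rep a v))))

    offset-translate : offset i ≡ j
    offset-translate = J.class-unique _
      (H.∼-trans (H.⊖-cong rep-i (H.≗⇒∼ λ v → cong (λ b → C.rep b v) coset-translate))
                 (H.≗⇒∼ λ v → identity (C.rep a v) (J.rep j v)))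
      where
      identity : ∀ r d → (r + d) - r ≡ d
      identity = solve-∀

  Fibre-irrelevant : Irrelevant Fibre
  Fibre-irrelevant = Decidable⇒UIP.≡-irrelevant _≟_

  decomposition : Fin N ↔ (Fin I × Σ (Fin N) Fibre)
  decomposition = mk↔ₛ′ to from to-from translate-offset
    where
    to : Fin N → Fin I × Σ (Fin N) Fibre
    to i = coset i , offset i , offset∈Fibre i
    from : Fin I × Σ (Fin N) Fibre → Fin N
    from (a , j , _) = translate a j
    to-from : ∀ x → to (from x) ≡ x
    to-from (a , j , p) = cong₂ _,_ (coset-translate a j p)
                                   (Σ-≡,≡→≡ (offset-translate a j p , Fibre-irrelevant _ _))

  index∣order : I ∣ N
  index∣order with Σ-Fin↔Fin (λ j → _ ≟ _) Fibre-irrelevant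
  ... | k , Fibre↔k = divides k (trans (↔⇒≡ N↔I*k) (ℕ.*-comm I k))
    where
    N↔I*k : Fin N ↔ Fin (I *ℕ k)
    N↔I*k = ↔-trans decomposition (↔-trans (×-cong ↔-refl Fibre↔k) (↔-sym *↔×))

Principal : Adj n → Pred (Div n) _
Principal {n} B D = ∃ λ (σ : Fin n → ℤ) → ∀ v → D v ≡ Lap B σ v

-- The preimage in Div of the subgroup of Jac generated by [δ x y].
Principal+ℤδ : Adj n → Fin n → Fin n → Pred (Div n) _
Principal+ℤδ {n} B x y D = ∃ λ (m : ℤ) → ∃ λ (σ : Fin n → ℤ) → ∀ v → D v ≡ Lap B σ v + m * δ x y v

Lap-⊖ : (B : Adj n) (σ τ : Fin n → ℤ) (v : Fin n) → Lap B (σ ⊖ τ) v ≡ Lap B σ v - Lap B τ v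
Lap-⊖ B σ τ v = begin
  valency B v * (σ v - τ v) - Σℤ (λ w → + B v w * (σ w - τ w))
    ≡⟨ cong (λ S → valency B v * (σ v - τ v) - S)
            (trans (Σℤ-cong λ w → distrib (+ B v w) (σ w) (τ w))
                   (Σℤ-- (λ w → + B v w * σ w) (λ w → + B v w * τ w))) ⟩
  valency B v * (σ v - τ v) - (Σℤ (λ w → + B v w * σ w) - Σℤ (λ w → + B v w * τ w))
    ≡⟨ regroup (valency B v) (σ v) (τ v) _ _ ⟩
  Lap B σ v - Lap B τ v ∎
  where
  open ≡-Reasoning
  distrib : ∀ a s t → a * (s - t) ≡ a * s - a * t
  distrib = solve-∀
  regroup : ∀ d s t S T → d * (s - t) - (S - T) ≡ (d * s - S) - (d * t - T)
  regroup = solve-∀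

Principal-isSubgroup : (B : Adj n) → IsSubgroup (Principal B)
Principal-isSubgroup B = record
  { respects-≗ = λ { D≗E (σ , p) → σ , λ v → trans (sym (D≗E v)) (p v) }
  -- 0ᴰ ⊖ 0ᴰ computes to 0ᴰ
  ; has-0ᴰ     = 0ᴰ , λ v → sym (trans (Lap-⊖ B 0ᴰ 0ᴰ v) (+-inverseʳ (Lap B 0ᴰ v)))
  ; ⊖-closed   = λ { (σ , p) (τ , q) →
      σ ⊖ τ , λ v → trans (cong₂ _-_ (p v) (q v)) (sym (Lap-⊖ B σ τ v)) }
  }

Principal⊆Principal+ℤδ : (B : Adj n) (x y : Fin n) → Principal B ⊆ Principal+ℤδ B x y
Principal⊆Principal+ℤδ B x y (σ , p) = + 0 , σ , λ v → trans (p v) (sym (+-identityʳ _))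

Principal+ℤδ-isSubgroup : (B : Adj n) (x y : Fin n) → IsSubgroup (Principal+ℤδ B x y)
Principal+ℤδ-isSubgroup B x y = record
  { respects-≗ = λ { D≗E (m , σ , p) → m , σ , λ v → trans (sym (D≗E v)) (p v) }
  ; has-0ᴰ     = Principal⊆Principal+ℤδ B x y (IsSubgroup.has-0ᴰ (Principal-isSubgroup B))
  ; ⊖-closed   = λ { (m , σ , p) (m′ , τ , q) →
      m - m′ , σ ⊖ τ , λ v →
        trans (cong₂ _-_ (p v) (q v))
              (trans (regroup (Lap B σ v) (Lap B τ v) m m′ (δ x y v))
                     (cong (_+ (m - m′) * δ x y v) (sym (Lap-⊖ B σ τ v)))) }
  }
  where
  regroup : ∀ L L′ m m′ d → (L + m * d) - (L′ + m′ * d) ≡ (L - L′) + (m - m′) * d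
  regroup = solve-∀

JacIndex∣JacOrder : (B : Adj n) (x y : Fin n) {N I : ℕ} → JacOrder B N → JacIndex B x y I → I ∣ N
JacIndex∣JacOrder B x y jac idx =
  Lagrange.index∣order (Principal-isSubgroup B) (Principal+ℤδ-isSubgroup B x y)
                       (Principal⊆Principal+ℤδ B x y)
                       (QuotCard-map (λ _ _ → ⟨_⟩) (λ D E → _∼[_]_.difference∈ {D = D} {E = E}) jac)
                       (QuotCard-map (λ _ _ → ⟨_⟩) (λ D E → _∼[_]_.difference∈ {D = D} {E = E}) idx)

Lap-update : (B B′ : Adj n) (σ : Fin n → ℤ) (v w₀ : Fin n) → (∀ w → ¬ w ≡ w₀ → B′ v w ≡ B v w) →
             Lap B′ σ v ≡ Lap B σ v + (+ B′ v w₀ - + B v w₀) * (σ v - σ w₀)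
Lap-update B B′ σ v w₀ agree = begin
  valency B′ v * σ v - Σℤ (λ w → + B′ v w * σ w)
    ≡⟨ cong₂ (λ V S → V * σ v - S)
             (Σℤ-update (λ w → + B′ v w) (λ w → + B v w) w₀ λ w w≢w₀ → cong +_ (agree w w≢w₀))
             (Σℤ-update (λ w → + B′ v w * σ w) (λ w → + B v w * σ w) w₀
                        λ w w≢w₀ → cong (λ b → + b * σ w) (agree w w≢w₀)) ⟩
  (valency B v + (b′ - b)) * σ v - (Σℤ (λ w → + B v w * σ w) + (b′ * σ w₀ - b * σ w₀))
    ≡⟨ regroup (valency B v) (σ v) _ b′ b (σ w₀) ⟩
  Lap B σ v + (b′ - b) * (σ v - σ w₀) ∎
  where
  open ≡-Reasoning
  b′ = + B′ v w₀
  b  = + B v w₀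
  regroup : ∀ V s S b′ b t → (V + (b′ - b)) * s - (S + (b′ * t - b * t)) ≡ (V * s - S) + (b′ - b) * (s - t)
  regroup = solve-∀

-- Changing the number of edges between x and y

isYes-true : ∀ {P : Set} (P? : Dec P) → P → ⌊ P? ⌋ ≡ true
isYes-true P? p = trans (isYes≗does P?) (dec-true P? p)

isYes-false : ∀ {P : Set} (P? : Dec P) → ¬ P → ⌊ P? ⌋ ≡ false
isYes-false P? ¬p = trans (isYes≗does P?) (dec-false P? ¬p)

δ-source : (x y : Fin n) → δ x y x ≡ - + 1
δ-source x y = cong (λ b → if b then - + 1 else (if ⌊ x ≟ y ⌋ then + 1 else + 0)) (isYes-true (x ≟ x) refl)

δ-target : {x y : Fin n} → ¬ x ≡ y → δ x y y ≡ + 1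
δ-target {x = x} {y} x≢y = cong₂ (λ b c → if b then - + 1 else (if c then + 1 else + 0))
                                 (isYes-false (y ≟ x) λ y≡x → x≢y (sym y≡x)) (isYes-true (y ≟ y) refl)

δ-elsewhere : {x y v : Fin n} → ¬ v ≡ x → ¬ v ≡ y → δ x y v ≡ + 0
δ-elsewhere {x = x} {y} {v} v≢x v≢y =
  cong₂ (λ b c → if b then - + 1 else (if c then + 1 else + 0))
        (isYes-false (v ≟ x) v≢x) (isYes-false (v ≟ y) v≢y)

Pair : Fin n → Fin n → Fin n → Fin n → Set
Pair x y u w = (u ≡ x × w ≡ y) ⊎ (u ≡ y × w ≡ x)

pair? : (x y u w : Fin n) → Dec (Pair x y u w)
pair? x y u w = (u ≟ x ×-dec w ≟ y) ⊎-dec (u ≟ y ×-dec w ≟ x)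

isPair≡does : (x y u w : Fin n) → isPair x y u w ≡ does (pair? x y u w)
isPair≡does x y u w = cong₂ _∨_ (cong₂ _∧_ (isYes≗does (u ≟ x)) (isYes≗does (w ≟ y)))
                                (cong₂ _∧_ (isYes≗does (u ≟ y)) (isYes≗does (w ≟ x)))

module _ (A : Adj n) (x y : Fin n) (k : ℤ) {u w : Fin n} where

  modify-off : ¬ Pair x y u w → modify A x y k u w ≡ A u w
  modify-off ¬pair = cong (λ b → if b then ∣ + A u w - k ∣ else A u w)
                          (trans (isPair≡does x y u w) (dec-false (pair? x y u w) ¬pair))

  modify-on : Pair x y u w → k ≤ℤ + A u w → + modify A x y k u w ≡ + A u w - k
  modify-on pair k≤A = trans (cong (λ b → + (if b then ∣ + A u w - k ∣ else A u w))
                                   (trans (isPair≡does x y u w) (dec-true (pair? x y u w) pair)))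
                             (0≤i⇒+∣i∣≡i (i≤j⇒0≤j-i k≤A))

LapAgreeModδ : Adj n → Adj n → Fin n → Fin n → Set
LapAgreeModδ {n} B B′ x y = (σ : Fin n → ℤ) → ∃ λ c → ∀ v → Lap B′ σ v ≡ Lap B σ v + c * δ x y v

LapAgreeModδ-sym : {B B′ : Adj n} {x y : Fin n} → LapAgreeModδ B B′ x y → LapAgreeModδ B′ B x y
LapAgreeModδ-sym {B = B} {B′} {x} {y} agree σ =
  - c , λ v → solve-for (Lap B σ v) (Lap B′ σ v) c (δ x y v) (c-spec v)
  where
  c = proj₁ (agree σ)
  c-spec = proj₂ (agree σ)
  solve-for : ∀ L L′ c d → L′ ≡ L + c * d → L ≡ L′ + - c * d
  solve-for L L′ c d refl = rearrange L c d
    where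
    rearrange : ∀ L c d → L ≡ (L + c * d) + - c * d
    rearrange = solve-∀

Principal+ℤδ-⊆ : {B B′ : Adj n} {x y : Fin n} → LapAgreeModδ B B′ x y →
                    Principal+ℤδ B x y ⊆ Principal+ℤδ B′ x y
Principal+ℤδ-⊆ {B = B} {B′} {x} {y} agree (m , σ , p) =
  m - c , σ , λ v → trans (p v) (solve-for (Lap B σ v) (Lap B′ σ v) (δ x y v) (c-spec v))
  where
  c = proj₁ (agree σ)
  c-spec = proj₂ (agree σ)
  solve-for : ∀ L L′ d → L′ ≡ L + c * d → L + m * d ≡ L′ + (m - c) * d
  solve-for L L′ d refl = rearrange L c m d
    where
    rearrange : ∀ L c m d → L + m * d ≡ (L + c * d) + (m - c) * d
    rearrange = solve-∀

JacIndex-transfer : {B B′ : Adj n} {x y : Fin n} {I : ℕ} →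
                    LapAgreeModδ B B′ x y → JacIndex B x y I → JacIndex B′ x y I
JacIndex-transfer agree =
  QuotCard-map (λ D E → Principal+ℤδ-⊆ agree {D ⊖ E})
               (λ D E → Principal+ℤδ-⊆ (LapAgreeModδ-sym agree) {D ⊖ E})

module _ (A : Adj n) (symA : Symmetric A) {x y : Fin n} (x≢y : ¬ x ≡ y) {k : ℤ} (k≤A : k ≤ℤ + A x y) where
  private
    A₁ = modify A x y k

  Lap-modify-source : ∀ σ → Lap A₁ σ x ≡ Lap A σ x + k * (σ x - σ y) * δ x y x
  Lap-modify-source σ = begin
    Lap A₁ σ x
      ≡⟨ Lap-update A A₁ σ x y (λ w w≢y → modify-off A x y k
           [ (λ (_ , w≡y) → w≢y w≡y) , (λ (x≡y , _) → x≢y x≡y) ]) ⟩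
    Lap A σ x + (+ A₁ x y - + A x y) * (σ x - σ y)
      ≡⟨ cong (λ a → Lap A σ x + (a - + A x y) * (σ x - σ y))
              (modify-on A x y k (inj₁ (refl , refl)) k≤A) ⟩
    Lap A σ x + ((+ A x y - k) - + A x y) * (σ x - σ y)
      ≡⟨ identity (Lap A σ x) (+ A x y) k (σ x) (σ y) ⟩
    Lap A σ x + k * (σ x - σ y) * - + 1
      ≡⟨ cong (λ d → Lap A σ x + k * (σ x - σ y) * d) (sym (δ-source x y)) ⟩
    Lap A σ x + k * (σ x - σ y) * δ x y x ∎
    where
    open ≡-Reasoning
    identity : ∀ L a k s t → L + ((a - k) - a) * (s - t) ≡ L + k * (s - t) * - + 1
    identity = solve-∀

  Lap-modify-target : ∀ σ → Lap A₁ σ y ≡ Lap A σ y + k * (σ x - σ y) * δ x y y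
  Lap-modify-target σ = begin
    Lap A₁ σ y
      ≡⟨ Lap-update A A₁ σ y x (λ w w≢x → modify-off A x y k
           [ (λ (y≡x , _) → x≢y (sym y≡x)) , (λ (_ , w≡x) → w≢x w≡x) ]) ⟩
    Lap A σ y + (+ A₁ y x - + A y x) * (σ y - σ x)
      ≡⟨ cong (λ a → Lap A σ y + (a - + A y x) * (σ y - σ x))
              (modify-on A x y k (inj₂ (refl , refl)) (subst (λ a → k ≤ℤ + a) (symA x y) k≤A)) ⟩
    Lap A σ y + ((+ A y x - k) - + A y x) * (σ y - σ x)
      ≡⟨ identity (Lap A σ y) (+ A y x) k (σ x) (σ y) ⟩
    Lap A σ y + k * (σ x - σ y) * + 1
      ≡⟨ cong (λ d → Lap A σ y + k * (σ x - σ y) * d) (sym (δ-target x≢y)) ⟩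
    Lap A σ y + k * (σ x - σ y) * δ x y y ∎
    where
    open ≡-Reasoning
    identity : ∀ L a k s t → L + ((a - k) - a) * (t - s) ≡ L + k * (s - t) * + 1
    identity = solve-∀

  Lap-modify-elsewhere : ∀ σ {v} → ¬ v ≡ x → ¬ v ≡ y →
                         Lap A₁ σ v ≡ Lap A σ v + k * (σ x - σ y) * δ x y v
  Lap-modify-elsewhere σ {v} v≢x v≢y = begin
    Lap A₁ σ v
      ≡⟨ Lap-update A A₁ σ v x (λ w _ → modify-off A x y k (v-outside w)) ⟩
    Lap A σ v + (+ A₁ v x - + A v x) * (σ v - σ x)
      ≡⟨ cong (λ a → Lap A σ v + (+ a - + A v x) * (σ v - σ x)) (modify-off A x y k (v-outside x)) ⟩
    Lap A σ v + (+ A v x - + A v x) * (σ v - σ x)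
      ≡⟨ cong (λ d → Lap A σ v + d * (σ v - σ x)) (+-inverseʳ (+ A v x)) ⟩
    Lap A σ v + + 0
      ≡⟨ cong (_+_ (Lap A σ v)) (sym (trans (cong (k * (σ x - σ y) *_) (δ-elsewhere v≢x v≢y))
                                         (*-zeroʳ (k * (σ x - σ y))))) ⟩
    Lap A σ v + k * (σ x - σ y) * δ x y v ∎
    where
    open ≡-Reasoning
    v-outside : ∀ w → ¬ Pair x y v w
    v-outside w = [ (λ (v≡x , _) → v≢x v≡x) , (λ (v≡y , _) → v≢y v≡y) ]

  Lap-modify : ∀ σ v → Lap A₁ σ v ≡ Lap A σ v + k * (σ x - σ y) * δ x y v
  Lap-modify σ v = by-cases (v ≟ x) (v ≟ y)
    where
    by-cases : Dec (v ≡ x) → Dec (v ≡ y) → Lap A₁ σ v ≡ Lap A σ v + k * (σ x - σ y) * δ x y v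
    by-cases (yes refl) _          = Lap-modify-source σ
    by-cases (no _)     (yes refl) = Lap-modify-target σ
    by-cases (no v≢x)   (no v≢y)   = Lap-modify-elsewhere σ v≢x v≢y

  modify-LapAgreeModδ : LapAgreeModδ A A₁ x y
  modify-LapAgreeModδ σ = k * (σ x - σ y) , Lap-modify σ

theorem3p4 : (n : ℕ) (A : Adj n) → Symmetric A → Loopless A → Connected A →
    (x y : Fin n) → ¬ (x ≡ y) → (k : ℤ) → k ≤ℤ + A x y →
    Connected (modify A x y k) →
    (N N₁ I I₁ : ℕ) →
    JacOrder A N → JacOrder (modify A x y k) N₁ →
    JacIndex A x y I → JacIndex (modify A x y k) x y I₁ →
    (I ∣ gcd N N₁) × (I₁ ∣ gcd N N₁)
theorem3p4 n A symA _ _ x y x≢y k k≤A _ N N₁ I I₁ jac jac₁ idx idx₁ =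
    gcd-greatest (JacIndex∣JacOrder A x y jac idx) (JacIndex∣JacOrder A₁ x y jac₁ (JacIndex-transfer agree idx))
  , gcd-greatest (JacIndex∣JacOrder A x y jac (JacIndex-transfer (LapAgreeModδ-sym agree) idx₁))
                 (JacIndex∣JacOrder A₁ x y jac₁ idx₁)
  where
  A₁ = modify A x y k
  agree : LapAgreeModδ A A₁ x y
  agree = modify-LapAgreeModδ A symA x≢y k≤A
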